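{- Let $G$ be a weak induced subhypergraph of a hypergraph $H$ such that $|E(G)|=|E(H)|$ and $E(G)$ contains no singleton edges. Then $b_L(G)\leq b_L(H)$.
   Context: A hypergraph $H$ consists of a nonempty finite vertex set $V(H)$ and a finite family $E(H)$ of edges, each a subset of $V(H)$; parallel and singleton edges are allowed. The weak subhypergraph induced by a nonempty set $V'\subseteq V(H)$ has vertex set $V'$ and edge family consisting of $e\cap V'$ for each $e\in E(H)$ with $e\cap V'\neq\emptyset$ (one edge for each such $e$, counted with multiplicity); a weak induced subhypergraph is one of this form. Lazy burning: a set $S\subseteq V(H)$ is set on fire; then repeatedly any unburned vertex $v$ lying in an edge $e$ with $|e|\geq 2$ such that all vertices of $e\setminus\{v\}$ are on fire catches fire; $S$ is a lazy burning set if eventually all vertices are on fire; $b_L(H)$ is the minimum size of a lazy burning set. -}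

module Defs where

open import Data.Nat using (ℕ; _≤_; _≥_)
open import Data.Fin using (Fin)
open import Data.Fin.Subset using (Subset; _∈_; _∉_; _⊆_; _∩_; ∣_∣; Nonempty)
open import Data.List using (List; map; filter; length)
open import Data.List.Relation.Unary.Any using (Any)
open import Data.List.Relation.Unary.All using (All)
open import Data.Product using (Σ; _×_; ∃)
open import Relation.Binary.PropositionalEquality using (_≡_; _≢_)
open import Relation.Nullary using (¬_)
open import Relation.Nullary.Decidable using (¬?)
import Data.Nat as ℕ

-- V(H) is a nonempty subset of Fin n; E(H) is a finite family (list, so
-- multiplicities / parallel edges are kept) of subsets of V(H).
record Hypergraph (n : ℕ) : Set where
  field
    V        : Subset n
    nonempty : Nonempty V
    E        : List (Subset n)
    edges⊆V  : All (λ e → e ⊆ V) E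
open Hypergraph public

weakInducedEdges : ∀ {n} → List (Subset n) → Subset n → List (Subset n)
weakInducedEdges E V' =
  map (λ e → e ∩ V') (filter (λ e → ¬? (∣ e ∩ V' ∣ ℕ.≟ 0)) E)


data OnFire {n} (H : Hypergraph n) (S : Subset n) : Fin n → Set where
  initial : ∀ {v} → v ∈ S → OnFire H S v
  spread  : ∀ {v} (e : Subset n) → Any (e ≡_) (E H) → 2 ≤ ∣ e ∣ → v ∈ e →
            (∀ u → u ∈ e → u ≢ v → OnFire H S u) → OnFire H S v

IsLazyBurningSet : ∀ {n} → Hypergraph n → Subset n → Set
IsLazyBurningSet H S = S ⊆ V H × (∀ v → v ∈ V H → OnFire H S v)

IsLazyBurningNumber : ∀ {n} → Hypergraph n → ℕ → Set
IsLazyBurningNumber H k =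
  (Σ (Subset _) λ S → IsLazyBurningSet H S × ∣ S ∣ ≡ k) ×
  (∀ S → IsLazyBurningSet H S → k ≤ ∣ S ∣)

IsWeakInducedSub : ∀ {n} → Hypergraph n → Hypergraph n → Set
IsWeakInducedSub G H = V G ⊆ V H × E G ≡ weakInducedEdges (E H) (V G)

module Submission where

open import Defs
open import Data.Nat using (_≤_; _<_; z≤n; s≤s)
open import Data.Nat.Properties using (≤∧≢⇒<; n>0⇒n≢0; ≤-trans)
open import Data.Fin using (Fin)
open import Data.Fin.Subset using (Subset; ∣_∣; _∈_; _∩_; inside; outside)
open import Data.Fin.Subset.Properties using (x∈p∩q⁺; x∈p∩q⁻; ∣p∩q∣≤∣p∣)
open import Data.List using (List; length)
open import Data.List.Relation.Unary.All using (All)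
import Data.List.Relation.Unary.All as All
open import Data.List.Relation.Unary.Any using (Any)
open import Data.List.Membership.Propositional.Properties using (∈-map⁺; ∈-filter⁺)
open import Data.Product using (_,_; proj₂)
open import Data.Vec using (_∷_; here; there)
open import Relation.Binary.PropositionalEquality using (_≡_; _≢_; subst; sym; ≢-sym)
open import Relation.Nullary.Decidable using (¬?)
import Data.Nat as ℕ

-- Restricting a burning sequence of H to V(G) burns G: an edge e of H that fires
-- v ∈ V(G) leaves the edge e ∩ V(G) of G, which contains v and so is not empty,
-- hence has at least two vertices because G has no singleton edges. Thus S ∩ V(G)
-- is a lazy burning set of G whenever S is one of H, and it is no larger than S.

x∈p⇒0<∣p∣ : ∀ {n} {x : Fin n} {p : Subset n} → x ∈ p → 0 < ∣ p ∣
x∈p⇒0<∣p∣ here = s≤s z≤n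
x∈p⇒0<∣p∣ {p = outside ∷ p} (there x∈p) = x∈p⇒0<∣p∣ x∈p
x∈p⇒0<∣p∣ {p = inside ∷ p} (there _) = s≤s z≤n

∈-weakInducedEdges⁺ : ∀ {n} {e V' : Subset n} {E : List (Subset n)} →
  Any (e ≡_) E → ∣ e ∩ V' ∣ ≢ 0 → Any ((e ∩ V') ≡_) (weakInducedEdges E V')
∈-weakInducedEdges⁺ {V' = V'} e∈E e∩V'≢∅ =
  ∈-map⁺ (_∩ V') (∈-filter⁺ (λ e → ¬? (∣ e ∩ V' ∣ ℕ.≟ 0)) e∈E e∩V'≢∅)

OnFire-restrict : ∀ {n} {G H : Hypergraph n} →
  E G ≡ weakInducedEdges (E H) (V G) → All (λ e → ∣ e ∣ ≢ 1) (E G) →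
  ∀ {S v} → OnFire H S v → v ∈ V G → OnFire G (S ∩ V G) v
OnFire-restrict _ _ (initial v∈S) v∈G = initial (x∈p∩q⁺ (v∈S , v∈G))
OnFire-restrict {G = G} E-G no-singletons {S} {v} (spread e e∈H _ v∈e burnt) v∈G =
  spread (e ∩ V G) e∩G∈G 2≤∣e∩G∣ v∈e∩G burnt∩G
  where
  v∈e∩G : v ∈ e ∩ V G
  v∈e∩G = x∈p∩q⁺ (v∈e , v∈G)

  e∩G∈G : Any ((e ∩ V G) ≡_) (E G)
  e∩G∈G = subst (Any ((e ∩ V G) ≡_)) (sym E-G)
    (∈-weakInducedEdges⁺ e∈H (n>0⇒n≢0 (x∈p⇒0<∣p∣ v∈e∩G)))

  2≤∣e∩G∣ : 2 ≤ ∣ e ∩ V G ∣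
  2≤∣e∩G∣ = ≤∧≢⇒< (x∈p⇒0<∣p∣ v∈e∩G) (≢-sym (All.lookup no-singletons e∩G∈G))

  burnt∩G : ∀ u → u ∈ e ∩ V G → u ≢ v → OnFire G (S ∩ V G) u
  burnt∩G u u∈e∩G u≢v with x∈p∩q⁻ e (V G) u∈e∩G
  ... | u∈e , u∈G = OnFire-restrict E-G no-singletons (burnt u u∈e u≢v) u∈G

IsLazyBurningSet-restrict : ∀ {n} {G H : Hypergraph n} → IsWeakInducedSub G H →
  All (λ e → ∣ e ∣ ≢ 1) (E G) →
  ∀ {S} → IsLazyBurningSet H S → IsLazyBurningSet G (S ∩ V G)
IsLazyBurningSet-restrict {G = G} (G⊆H , E-G) no-singletons {S} (_ , burns) =
  (λ v∈S∩G → proj₂ (x∈p∩q⁻ S (V G) v∈S∩G)) ,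
  λ v v∈G → OnFire-restrict E-G no-singletons (burns v (G⊆H v∈G)) v∈G

mainTheorem18 : ∀ {n} (G H : Hypergraph n) → IsWeakInducedSub G H →
    length (E G) ≡ length (E H) →
    All (λ e → ∣ e ∣ ≢ 1) (E G) →
    ∀ kG kH → IsLazyBurningNumber G kG → IsLazyBurningNumber H kH →
    kG ≤ kH
mainTheorem18 G H G≤H _ no-singletons kG kH (_ , minimalG) ((S , burnsH , ∣S∣≡kH) , _) =
  subst (kG ≤_) ∣S∣≡kH
    (≤-trans (minimalG (S ∩ V G) (IsLazyBurningSet-restrict G≤H no-singletons burnsH))
             (∣p∩q∣≤∣p∣ S (V G)))
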